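{- Let $G$ be a graph of order $n\geq 3$ having exactly $k\geq 1$ vertices of degree $n-1$. Then $b_{dR}(G)=\lceil k/2\rceil$.
   Context: All graphs are finite, simple and undirected. For a graph $G=(V,E)$, a double Roman dominating function (DRDF) is a function $f:V\to\{0,1,2,3\}$ such that every vertex $v$ with $f(v)=0$ has at least two neighbors $u$ with $f(u)=2$ or at least one neighbor $w$ with $f(w)=3$, and every vertex $v$ with $f(v)=1$ has at least one neighbor $w$ with $f(w)\geq 2$. The weight of $f$ is $\sum_{u\in V}f(u)$, and $\gamma_{dR}(G)$ is the minimum weight of a DRDF on $G$. The double Roman bondage number $b_{dR}(G)$ of a graph $G$ with at least one edge is the minimum cardinality of an edge set $B\subseteq E(G)$ such that $\gamma_{dR}(G-B)>\gamma_{dR}(G)$, where $G-B$ is the spanning subgraph obtained by deleting the edges of $B$. -}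

module Defs where

open import Data.Nat using (ℕ; zero; suc; _+_; _∸_; _≤_; _<_; _<ᵇ_)
open import Data.Fin using (Fin; toℕ)
import Data.Fin as F
open import Data.Bool using (Bool; true; false; _∧_; not; if_then_else_)
open import Data.Product using (Σ; ∃; _×_; _,_)
open import Data.Sum using (_⊎_)
open import Relation.Binary.PropositionalEquality using (_≡_; _≢_)

record Graph (n : ℕ) : Set where
  field
    adj   : Fin n → Fin n → Bool
    sym   : ∀ i j → adj i j ≡ adj j i
    irrefl : ∀ i → adj i i ≡ false
open Graph public

count : ∀ {n} → (Fin n → Bool) → ℕ
count {zero}  p = 0
count {suc n} p = (if p F.zero then 1 else 0) + count (λ i → p (F.suc i))

sumF : ∀ {n} → (Fin n → ℕ) → ℕ
sumF {zero}  f = 0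
sumF {suc n} f = f F.zero + sumF (λ i → f (F.suc i))

degree : ∀ {n} → Graph n → Fin n → ℕ
degree G v = count (adj G v)

numFullDegree : ∀ {n} → Graph n → ℕ
numFullDegree {n} G = count (λ v → degree G v Data.Nat.≡ᵇ (n ∸ 1))
  where import Data.Nat

Adj : ∀ {n} → Graph n → Fin n → Fin n → Set
Adj G u v = adj G u v ≡ true

IsDRDF : ∀ {n} → Graph n → (Fin n → ℕ) → Set
IsDRDF {n} G f =
  (∀ v → f v ≤ 3)
  × (∀ v → f v ≡ 0 →
       (Σ (Fin n) λ u → Σ (Fin n) λ u' →
          u ≢ u' × Adj G v u × Adj G v u' × f u ≡ 2 × f u' ≡ 2)
       ⊎ (Σ (Fin n) λ w → Adj G v w × f w ≡ 3))
  × (∀ v → f v ≡ 1 → Σ (Fin n) λ w → Adj G v w × 2 ≤ f w)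

weight : ∀ {n} → (Fin n → ℕ) → ℕ
weight f = sumF f

IsGammaDR : ∀ {n} → Graph n → ℕ → Set
IsGammaDR {n} G g =
  (Σ (Fin n → ℕ) λ f → IsDRDF G f × weight f ≡ g)
  × (∀ f → IsDRDF G f → g ≤ weight f)

record EdgeSubset {n : ℕ} (G : Graph n) : Set where
  field
    mem    : Fin n → Fin n → Bool
    memSym : ∀ i j → mem i j ≡ mem j i
    memSub : ∀ i j → mem i j ≡ true → adj G i j ≡ true
open EdgeSubset public

edgeCount : ∀ {n} {G : Graph n} → EdgeSubset G → ℕ
edgeCount B = sumF (λ i → count (λ j → mem B i j ∧ (toℕ i <ᵇ toℕ j)))

deleteEdges : ∀ {n} (G : Graph n) → EdgeSubset G → Graph n
deleteEdges G B = record
  { adj = λ i j → adj G i j ∧ not (mem B i j)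
  ; sym = sym'
  ; irrefl = irr }
  where
    open import Relation.Binary.PropositionalEquality using (cong₂)
    sym' : ∀ i j → (adj G i j ∧ not (mem B i j)) ≡ (adj G j i ∧ not (mem B j i))
    sym' i j = cong₂ (λ a b → a ∧ not b) (Graph.sym G i j) (memSym B i j)
    irr : ∀ i → (adj G i i ∧ not (mem B i i)) ≡ false
    irr i rewrite Graph.irrefl G i = Relation.Binary.PropositionalEquality.refl
      where import Relation.Binary.PropositionalEquality

IncreasesGammaDR : ∀ {n} (G : Graph n) → EdgeSubset G → Set
IncreasesGammaDR G B =
  ∀ g g' → IsGammaDR G g → IsGammaDR (deleteEdges G B) g' → g < g'

IsDRBondage : ∀ {n} → Graph n → ℕ → Set
IsDRBondage G b =
  (Σ (EdgeSubset G) λ B → IncreasesGammaDR G B × edgeCount B ≡ b)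
  × (∀ B → IncreasesGammaDR G B → b ≤ edgeCount B)

-- On n ≥ 3 vertices γ_dR(H) = 3 when H has a vertex of full degree n − 1 (put 3 on it), and
-- γ_dR(H) ≥ 4 otherwise, since a DRDF of weight at most 3 must put 3 on a vertex adjacent to all
-- others. So deleting B raises γ_dR(G) = 3 exactly when G − B has no full-degree vertex. Deleting
-- one edge destroys full degree at most at its two endpoints and creates none, so ⌈k/2⌉ edges are
-- needed; deleting edges that pair up the k full vertices (the last one, if k is odd, with any
-- other vertex) shows that ⌈k/2⌉ edges suffice.

module Submission where

open import Defs hiding (sym)
open import Data.Nat
  using (ℕ; zero; suc; _+_; _≤_; _<_; _∸_; _<ᵇ_; _≡ᵇ_; z≤n; s≤s; _≤?_; ⌈_/2⌉)
open import Data.Nat.Properties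
open import Data.Nat.Tactic.RingSolver using (solve-∀)
open import Data.Fin using (Fin; toℕ; punchIn; punchOut)
import Data.Fin as Fin
open import Data.Fin.Properties
  using (any?; punchInᵢ≢i; punchIn-punchOut; punchIn-injective)
  renaming (_≟_ to _≟ᶠ_; <-cmp to <-cmpᶠ)
open import Data.Bool using (Bool; true; false; _∧_; _∨_; not; if_then_else_)
open import Data.Bool.Properties
  using ( ∧-conicalˡ; ∧-conicalʳ; ∧-zeroʳ; ∧-identityʳ; ∨-zeroʳ; ∨-identityʳ; ∧-distribʳ-∨
        ; ¬-not; T-≡)
  renaming (_≟_ to _≟ᵇ_)
open import Data.Product using (Σ; ∃; _×_; _,_; proj₁; proj₂)
open import Data.Sum using (_⊎_; inj₁; inj₂; [_,_])
import Data.Sum as Sum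
import Data.Product as Product
open import Data.Empty using (⊥-elim)
open import Function using (_∘_; mk⇔; Equivalence)
open import Relation.Nullary using (¬_; Dec; yes; no; does; contradiction)
open import Relation.Nullary.Decidable using (dec-true; dec-false; does-⇔; _×-dec_; _⊎-dec_)
open import Relation.Binary using (tri<; tri≈; tri>)
open import Relation.Binary.PropositionalEquality
  using (_≡_; _≢_; refl; sym; trans; cong; cong₂; subst; subst₂; ≢-sym; module ≡-Reasoning)

ind : Bool → ℕ
ind b = if b then 1 else 0

ind≤1 : ∀ b → ind b ≤ 1
ind≤1 true  = ≤-refl
ind≤1 false = z≤n

sumF-cong : ∀ {n} {f g : Fin n → ℕ} → (∀ i → f i ≡ g i) → sumF f ≡ sumF g
sumF-cong {zero}  f≗g = refl
sumF-cong {suc n} f≗g = cong₂ _+_ (f≗g Fin.zero) (sumF-cong (f≗g ∘ Fin.suc))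

sumF-mono : ∀ {n} {f g : Fin n → ℕ} → (∀ i → f i ≤ g i) → sumF f ≤ sumF g
sumF-mono {zero}  f≤g = z≤n
sumF-mono {suc n} f≤g = +-mono-≤ (f≤g Fin.zero) (sumF-mono (f≤g ∘ Fin.suc))

sumF-zero : ∀ {n} {f : Fin n → ℕ} → (∀ i → f i ≡ 0) → sumF f ≡ 0
sumF-zero {zero}  f≗0 = refl
sumF-zero {suc n} f≗0 = cong₂ _+_ (f≗0 Fin.zero) (sumF-zero (f≗0 ∘ Fin.suc))

n≤sumF : ∀ {n} {f : Fin n → ℕ} → (∀ i → 1 ≤ f i) → n ≤ sumF f
n≤sumF {zero}  f≥1 = z≤n
n≤sumF {suc n} f≥1 = +-mono-≤ (f≥1 Fin.zero) (n≤sumF (f≥1 ∘ Fin.suc))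

sumF-punchIn : ∀ {n} (f : Fin (suc n) → ℕ) i → sumF f ≡ f i + sumF (f ∘ punchIn i)
sumF-punchIn f Fin.zero = refl
sumF-punchIn {suc n} f (Fin.suc i) = begin
  f Fin.zero + sumF (f ∘ Fin.suc)
    ≡⟨ cong (f Fin.zero +_) (sumF-punchIn (f ∘ Fin.suc) i) ⟩
  f Fin.zero + (f (Fin.suc i) + rest)
    ≡⟨ +-comm-middle (f Fin.zero) (f (Fin.suc i)) rest ⟩
  f (Fin.suc i) + (f Fin.zero + rest)
    ∎
  where
  open ≡-Reasoning
  rest : ℕ
  rest = sumF (f ∘ Fin.suc ∘ punchIn i)
  +-comm-middle : ∀ x y z → x + (y + z) ≡ y + (x + z)
  +-comm-middle = solve-∀

point≤sumF : ∀ {n} (f : Fin n → ℕ) i → f i ≤ sumF f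
point≤sumF {suc n} f i = subst (f i ≤_) (sym (sumF-punchIn f i)) (m≤m+n (f i) _)

pair≤sumF : ∀ {n} (f : Fin n → ℕ) {i j} → i ≢ j → f i + f j ≤ sumF f
pair≤sumF {suc n} f {i} {j} i≢j = subst (f i + f j ≤_) (sym (sumF-punchIn f i))
  (+-monoʳ-≤ (f i) (subst (_≤ sumF (f ∘ punchIn i)) (cong f (punchIn-punchOut i≢j))
    (point≤sumF (f ∘ punchIn i) (punchOut i≢j))))

sumF-increment : ∀ {n} {f g : Fin (suc n) → ℕ} i → (∀ j → g (punchIn i j) ≡ f (punchIn i j)) →
                 g i ≡ suc (f i) → sumF g ≡ suc (sumF f)
sumF-increment {f = f} {g} i same gi = begin
  sumF g                          ≡⟨ sumF-punchIn g i ⟩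
  g i + sumF (g ∘ punchIn i)      ≡⟨ cong₂ _+_ gi (sumF-cong same) ⟩
  suc (f i + sumF (f ∘ punchIn i)) ≡⟨ cong suc (sym (sumF-punchIn f i)) ⟩
  suc (sumF f)                    ∎
  where open ≡-Reasoning

count≡sumF : ∀ {n} (p : Fin n → Bool) → count p ≡ sumF (ind ∘ p)
count≡sumF {zero}  p = refl
count≡sumF {suc n} p = cong (ind (p Fin.zero) +_) (count≡sumF (p ∘ Fin.suc))

count-cong : ∀ {n} {p q : Fin n → Bool} → (∀ i → p i ≡ q i) → count p ≡ count q
count-cong {p = p} {q} p≗q = trans (count≡sumF p)
  (trans (sumF-cong (cong ind ∘ p≗q)) (sym (count≡sumF q)))

count-punchIn : ∀ {n} (p : Fin (suc n) → Bool) i → count p ≡ ind (p i) + count (p ∘ punchIn i)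
count-punchIn p i = trans (count≡sumF p)
  (trans (sumF-punchIn (ind ∘ p) i) (cong (ind (p i) +_) (sym (count≡sumF (p ∘ punchIn i)))))

count-increment : ∀ {n} {p q : Fin (suc n) → Bool} i → (∀ j → q (punchIn i j) ≡ p (punchIn i j)) →
                  p i ≡ false → q i ≡ true → count q ≡ suc (count p)
count-increment {p = p} {q} i same pi qi = begin
  count q                  ≡⟨ count≡sumF q ⟩
  sumF (ind ∘ q)           ≡⟨ sumF-increment {f = ind ∘ p} {g = ind ∘ q} i (cong ind ∘ same)
                                (trans (cong ind qi) (cong (suc ∘ ind) (sym pi))) ⟩
  suc (sumF (ind ∘ p))     ≡⟨ cong suc (sym (count≡sumF p)) ⟩
  suc (count p)            ∎
  where open ≡-Reasoning

count-false : ∀ {n} {p : Fin n → Bool} → (∀ i → p i ≡ false) → count p ≡ 0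
count-false {p = p} p≗false = trans (count≡sumF p) (sumF-zero (cong ind ∘ p≗false))

count-pos : ∀ {n} (p : Fin n → Bool) {i} → p i ≡ true → 1 ≤ count p
count-pos {suc n} p {i} pi = subst (1 ≤_)
  (sym (trans (count-punchIn p i) (cong (λ b → ind b + count (p ∘ punchIn i)) pi))) (s≤s z≤n)

count-mono : ∀ {n} {p q : Fin n → Bool} → (∀ i → p i ≡ true → q i ≡ true) → count p ≤ count q
count-mono {p = p} {q} p⊆q = subst₂ _≤_ (sym (count≡sumF p)) (sym (count≡sumF q))
  (sumF-mono (λ i → ind-mono (p⊆q i)))
  where
  ind-mono : ∀ {x y} → (x ≡ true → y ≡ true) → ind x ≤ ind y
  ind-mono {false} _ = z≤n
  ind-mono {true}  x⇒y rewrite x⇒y refl = ≤-refl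

count≤n : ∀ {n} (p : Fin n → Bool) → count p ≤ n
count≤n {zero}  p = z≤n
count≤n {suc n} p = +-mono-≤ (ind≤1 (p Fin.zero)) (count≤n (p ∘ Fin.suc))

count≡n⇒all : ∀ {n} {p : Fin n → Bool} → count p ≡ n → ∀ i → p i ≡ true
count≡n⇒all {suc n} {p} all i with p i in pi
... | true  = refl
... | false = ⊥-elim (1+n≰n (subst (_≤ n) rest≡1+n (count≤n (p ∘ punchIn i))))
  where
  rest≡1+n : count (p ∘ punchIn i) ≡ suc n
  rest≡1+n = trans (cong (λ b → ind b + count (p ∘ punchIn i)) (sym pi))
                   (trans (sym (count-punchIn p i)) all)

all⇒count≡n : ∀ {n} {p : Fin n → Bool} → (∀ i → p i ≡ true) → count p ≡ n
all⇒count≡n {zero}  all = refl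
all⇒count≡n {suc n} all = cong₂ _+_ (cong ind (all Fin.zero)) (all⇒count≡n (all ∘ Fin.suc))

count-witness : ∀ {n} {p : Fin n → Bool} → 1 ≤ count p → ∃ λ i → p i ≡ true
count-witness {p = p} pos with any? (λ i → p i ≟ᵇ true)
... | yes found = found
... | no none = contradiction (count-false (λ i → ¬-not (λ pi → none (i , pi))))
                              (λ count≡0 → 1+n≰n (subst (1 ≤_) count≡0 pos))

Universal : ∀ {n} → Graph n → Fin n → Set
Universal H v = ∀ w → v ≢ w → Adj H v w

-- chosen so that numFullDegree H is count (full H) definitionally
full : ∀ {n} → Graph n → Fin n → Bool
full {n} H v = degree H v ≡ᵇ (n ∸ 1)

adj⇒≢ : ∀ {n} (H : Graph n) {v w} → Adj H v w → v ≢ w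
adj⇒≢ H {v} vw refl with trans (sym vw) (irrefl H v)
... | ()

degree-punchIn : ∀ {n} (H : Graph (suc n)) v → degree H v ≡ count (adj H v ∘ punchIn v)
degree-punchIn H v = trans (count-punchIn (adj H v) v)
  (cong (λ b → ind b + count (adj H v ∘ punchIn v)) (irrefl H v))

universal⇒full : ∀ {n} (H : Graph (suc n)) {v} → Universal H v → full H v ≡ true
universal⇒full H {v} univ = Equivalence.to T-≡ (≡⇒≡ᵇ _ _ (trans (degree-punchIn H v)
  (all⇒count≡n (λ i → univ (punchIn v i) (≢-sym (punchInᵢ≢i v i))))))

full⇒universal : ∀ {n} (H : Graph (suc n)) {v} → full H v ≡ true → Universal H v
full⇒universal {n} H {v} fv w v≢w = subst (Adj H v) (punchIn-punchOut v≢w)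
  (count≡n⇒all degree≡n (punchOut v≢w))
  where
  degree≡n : count (adj H v ∘ punchIn v) ≡ n
  degree≡n = trans (sym (degree-punchIn H v)) (≡ᵇ⇒≡ _ _ (Equivalence.from T-≡ fv))

numFullDegree-pos⇒universal : ∀ {n} (H : Graph (suc n)) → 1 ≤ numFullDegree H → ∃ (Universal H)
numFullDegree-pos⇒universal H pos = Product.map₂ (full⇒universal H) (count-witness {p = full H} pos)

universal⇒numFullDegree-pos : ∀ {n} (H : Graph (suc n)) {v} → Universal H v → 1 ≤ numFullDegree H
universal⇒numFullDegree-pos H univ = count-pos (full H) (universal⇒full H univ)

Linked : ∀ {n} → Fin n → Fin n → Fin n → Fin n → Set
Linked a b i j = (i ≡ a × j ≡ b) ⊎ (i ≡ b × j ≡ a)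

linked? : ∀ {n} (a b i j : Fin n) → Dec (Linked a b i j)
linked? a b i j = (i ≟ᶠ a ×-dec j ≟ᶠ b) ⊎-dec (i ≟ᶠ b ×-dec j ≟ᶠ a)

link : ∀ {n} → Fin n → Fin n → Fin n → Fin n → Bool
link a b i j = does (linked? a b i j)

link-sym : ∀ {n} (a b i j : Fin n) → link a b i j ≡ link a b j i
link-sym a b i j = does-⇔ (mk⇔ flip flip) (linked? a b i j) (linked? a b j i)
  where
  flip : ∀ {A B C D : Set} → (A × B) ⊎ (C × D) → (D × C) ⊎ (B × A)
  flip = Sum.swap ∘ Sum.map Product.swap Product.swap

link-swap : ∀ {n} (a b i j : Fin n) → link a b i j ≡ link b a i j
link-swap a b i j = does-⇔ (mk⇔ Sum.swap Sum.swap) (linked? a b i j) (linked? b a i j)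

link-ab : ∀ {n} (a b : Fin n) → link a b a b ≡ true
link-ab a b = dec-true (linked? a b a b) (inj₁ (refl , refl))

link-sound : ∀ {n} (a b i j : Fin n) → link a b i j ≡ true → Linked a b i j
link-sound a b i j = witness (linked? a b i j)
  where
  witness : ∀ {A : Set} (d : Dec A) → does d ≡ true → A
  witness (yes x) _ = x

link-off : ∀ {n} {a b i : Fin n} j → i ≢ a → i ≢ b → link a b i j ≡ false
link-off {a = a} {b} {i} j i≢a i≢b = dec-false (linked? a b i j) [ i≢a ∘ proj₁ , i≢b ∘ proj₁ ]

module _ {n} {a b : Fin (suc (suc n))} (a≢b : a ≢ b) where

  -- enumerates the vertices other than a and b
  skip₂ : Fin n → Fin (suc (suc n))
  skip₂ = punchIn a ∘ punchIn (punchOut a≢b)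

  skip₂≢a : ∀ i → skip₂ i ≢ a
  skip₂≢a i = punchInᵢ≢i a _

  skip₂≢b : ∀ i → skip₂ i ≢ b
  skip₂≢b i eq = punchInᵢ≢i (punchOut a≢b) i
    (punchIn-injective a _ _ (trans eq (sym (punchIn-punchOut a≢b))))

  count-skip₂ : ∀ p → count p ≡ ind (p a) + ind (p b) + count (p ∘ skip₂)
  count-skip₂ p = begin
    count p
      ≡⟨ count-punchIn p a ⟩
    ind (p a) + count (p ∘ punchIn a)
      ≡⟨ cong (ind (p a) +_) (count-punchIn (p ∘ punchIn a) (punchOut a≢b)) ⟩
    ind (p a) + (ind (p (punchIn a (punchOut a≢b))) + count (p ∘ skip₂))
      ≡⟨ cong (λ v → ind (p a) + (ind (p v) + count (p ∘ skip₂))) (punchIn-punchOut a≢b) ⟩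
    ind (p a) + (ind (p b) + count (p ∘ skip₂))
      ≡⟨ sym (+-assoc (ind (p a)) (ind (p b)) _) ⟩
    ind (p a) + ind (p b) + count (p ∘ skip₂)
      ∎
    where open ≡-Reasoning

  pair+count≤count : ∀ {p q} → (∀ v → q v ≡ true → p v ≡ true) → q a ≡ false → q b ≡ false →
                     ind (p a) + ind (p b) + count q ≤ count p
  pair+count≤count {p} {q} q⊆p qa qb = begin
    ind (p a) + ind (p b) + count q
      ≡⟨ cong (ind (p a) + ind (p b) +_) (count-skip₂ q) ⟩
    ind (p a) + ind (p b) + (ind (q a) + ind (q b) + count (q ∘ skip₂))
      ≡⟨ cong₂ (λ x y → ind (p a) + ind (p b) + (ind x + ind y + count (q ∘ skip₂))) qa qb ⟩
    ind (p a) + ind (p b) + count (q ∘ skip₂)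
      ≤⟨ +-monoʳ-≤ (ind (p a) + ind (p b)) (count-mono (q⊆p ∘ skip₂)) ⟩
    ind (p a) + ind (p b) + count (p ∘ skip₂)
      ≡⟨ sym (count-skip₂ p) ⟩
    count p
      ∎
    where open ≤-Reasoning

  count≤pair+count : ∀ {p q} → (∀ v → v ≢ a → v ≢ b → p v ≡ true → q v ≡ true) →
                     count p ≤ ind (p a) + ind (p b) + count q
  count≤pair+count {p} {q} p⊆q = begin
    count p
      ≡⟨ count-skip₂ p ⟩
    ind (p a) + ind (p b) + count (p ∘ skip₂)
      ≤⟨ +-monoʳ-≤ (ind (p a) + ind (p b))
                   (count-mono (λ i → p⊆q (skip₂ i) (skip₂≢a i) (skip₂≢b i))) ⟩
    ind (p a) + ind (p b) + count (q ∘ skip₂)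
      ≤⟨ +-monoʳ-≤ (ind (p a) + ind (p b)) (m≤n+m (count (q ∘ skip₂)) (ind (q a) + ind (q b))) ⟩
    ind (p a) + ind (p b) + (ind (q a) + ind (q b) + count (q ∘ skip₂))
      ≡⟨ cong (ind (p a) + ind (p b) +_) (sym (count-skip₂ q)) ⟩
    ind (p a) + ind (p b) + count q
      ∎
    where open ≤-Reasoning

record WithoutEdge {n} (H : Graph n) (a b : Fin n) (H′ : Graph n) : Set where
  field adj-without : ∀ i j → adj H′ i j ≡ (adj H i j ∧ not (link a b i j))
open WithoutEdge

module _ {n} {H H′ : Graph n} {a b} (removed : WithoutEdge H a b H′) where
  universal-⊆ : ∀ {v} → Universal H′ v → Universal H v
  universal-⊆ {v} univ w v≢w = ∧-conicalˡ _ _ (trans (sym (adj-without removed v w)) (univ w v≢w))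

  ¬adj-removed : ¬ Adj H′ a b
  ¬adj-removed ab = contradiction (trans (sym ab) ab-removed) λ ()
    where
    ab-removed : adj H′ a b ≡ false
    ab-removed = trans (adj-without removed a b)
      (trans (cong (λ x → adj H a b ∧ not x) (link-ab a b)) (∧-zeroʳ (adj H a b)))

  universal-off : ∀ {v} → v ≢ a → v ≢ b → Universal H v → Universal H′ v
  universal-off {v} v≢a v≢b univ w v≢w =
    trans (adj-without removed v w) (cong₂ (λ x y → x ∧ not y) (univ w v≢w) (link-off w v≢a v≢b))

module _ {n} {H H′ : Graph (suc (suc n))} {a b} (a≢b : a ≢ b) (removed : WithoutEdge H a b H′) where

  numFullDegree-loses-endpoints : ind (full H a) + ind (full H b) + numFullDegree H′ ≤ numFullDegree H
  numFullDegree-loses-endpoints = pair+count≤count a≢b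
    (λ v → universal⇒full H ∘ universal-⊆ removed ∘ full⇒universal H′)
    (¬-not λ fa → ¬adj-removed removed (full⇒universal H′ fa b a≢b))
    (¬-not λ fb → ¬adj-removed removed
      (trans (Graph.sym H′ a b) (full⇒universal H′ fb a (≢-sym a≢b))))

  numFullDegree-loses-≤2 : numFullDegree H ≤ 2 + numFullDegree H′
  numFullDegree-loses-≤2 = ≤-trans
    (count≤pair+count a≢b (λ v v≢a v≢b →
      universal⇒full H′ ∘ universal-off removed v≢a v≢b ∘ full⇒universal H))
    (+-monoˡ-≤ (numFullDegree H′) (+-mono-≤ (ind≤1 (full H a)) (ind≤1 (full H b))))

record WithEdge {n} {G : Graph n} (B : EdgeSubset G) (a b : Fin n) (B′ : EdgeSubset G) : Set where
  field
    new     : mem B a b ≡ false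
    mem-add : ∀ i j → mem B′ i j ≡ (mem B i j ∨ link a b i j)
open WithEdge

module _ {n} {G : Graph n} where

  insertEdge : (B : EdgeSubset G) {a b : Fin n} → Adj G a b → EdgeSubset G
  insertEdge B {a} {b} ab = record
    { mem    = λ i j → mem B i j ∨ link a b i j
    ; memSym = λ i j → cong₂ _∨_ (memSym B i j) (link-sym a b i j)
    ; memSub = sub
    }
    where
    sub : ∀ i j → (mem B i j ∨ link a b i j) ≡ true → Adj G i j
    sub i j e with mem B i j in inB
    ... | true = memSub B i j inB
    ... | false with link-sound a b i j e
    ...   | inj₁ (refl , refl) = ab
    ...   | inj₂ (refl , refl) = trans (Graph.sym G i j) ab

  removeEdge : EdgeSubset G → Fin n → Fin n → EdgeSubset G
  removeEdge B a b = record
    { mem    = λ i j → mem B i j ∧ not (link a b i j)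
    ; memSym = λ i j → cong₂ (λ x y → x ∧ not y) (memSym B i j) (link-sym a b i j)
    ; memSub = λ i j e → memSub B i j (∧-conicalˡ _ _ e)
    }

  withEdge-insert : ∀ B {a b} (ab : Adj G a b) → mem B a b ≡ false → WithEdge B a b (insertEdge B ab)
  withEdge-insert B ab fresh = record { new = fresh ; mem-add = λ i j → refl }

  withEdge-remove : ∀ B {a b} → mem B a b ≡ true → WithEdge (removeEdge B a b) a b B
  withEdge-remove B {a} {b} ab∈B = record
    { new     = trans (cong (λ x → mem B a b ∧ not x) (link-ab a b)) (∧-zeroʳ (mem B a b))
    ; mem-add = restored
    }
    where
    restored : ∀ i j → mem B i j ≡ (mem B i j ∧ not (link a b i j) ∨ link a b i j)
    restored i j with link a b i j in e
    ... | false = sym (trans (∨-identityʳ _) (∧-identityʳ _))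
    ... | true with link-sound a b i j e
    ...   | inj₁ (refl , refl) = trans ab∈B (sym (∨-zeroʳ _))
    ...   | inj₂ (refl , refl) = trans (trans (memSym B i j) ab∈B) (sym (∨-zeroʳ _))

  withEdge-swap : ∀ {B B′ : EdgeSubset G} {a b} → WithEdge B a b B′ → WithEdge B b a B′
  withEdge-swap {B} {a = a} {b} added = record
    { new     = trans (memSym B b a) (new added)
    ; mem-add = λ i j → trans (mem-add added i j) (cong (mem B i j ∨_) (link-swap a b i j))
    }

  deleteEdges-withEdge : ∀ {B B′ : EdgeSubset G} {a b} → WithEdge B a b B′ →
                         WithoutEdge (deleteEdges G B) a b (deleteEdges G B′)
  deleteEdges-withEdge {B} {a = a} {b} added = record
    { adj-without = λ i j → trans (cong (λ m → adj G i j ∧ not m) (mem-add added i j))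
                                  (∧-not-∨ (adj G i j) (mem B i j) (link a b i j)) }
    where
    ∧-not-∨ : ∀ x y z → x ∧ not (y ∨ z) ≡ (x ∧ not y) ∧ not z
    ∧-not-∨ false y     z = refl
    ∧-not-∨ true  true  z = refl
    ∧-not-∨ true  false z = refl

module _ {n} {G : Graph (suc n)} where

  -- edgeCount B sums the rows of upper B, counting each edge at its smaller endpoint
  upper : EdgeSubset G → Fin (suc n) → Fin (suc n) → Bool
  upper B i j = mem B i j ∧ (toℕ i <ᵇ toℕ j)

  edgeCount-withEdge< : ∀ {B B′ : EdgeSubset G} {a b} → toℕ a < toℕ b → WithEdge B a b B′ →
                        edgeCount B′ ≡ suc (edgeCount B)
  edgeCount-withEdge< {B} {B′} {a} {b} a<b added =
    sumF-increment {f = λ i → count (upper B i)} {g = λ i → count (upper B′ i)} a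
    (λ i → count-cong (λ j → unchanged (punchIn a i) j (punchInᵢ≢i a i ∘ proj₁)))
    (count-increment {p = upper B a} {q = upper B′ a} b
      (λ j → unchanged a (punchIn b j) (punchInᵢ≢i b j ∘ proj₂))
      (cong (_∧ (toℕ a <ᵇ toℕ b)) (new added)) upper-ab)
    where
    a<ᵇb : (toℕ a <ᵇ toℕ b) ≡ true
    a<ᵇb = Equivalence.to T-≡ (<⇒<ᵇ a<b)

    upper-ab : upper B′ a b ≡ true
    upper-ab = cong₂ _∧_ (trans (mem-add added a b)
      (trans (cong (mem B a b ∨_) (link-ab a b)) (∨-zeroʳ (mem B a b)))) a<ᵇb

    oriented-link : ∀ {i j} → ¬ (i ≡ a × j ≡ b) → link a b i j ∧ (toℕ i <ᵇ toℕ j) ≡ false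
    oriented-link {i} {j} ¬ab with link a b i j in e
    ... | false = refl
    ... | true with link-sound a b i j e
    ...   | inj₁ ab = contradiction ab ¬ab
    ...   | inj₂ (refl , refl) =
            ¬-not (λ b<ᵇa → <-asym a<b (<ᵇ⇒< (toℕ b) (toℕ a) (Equivalence.from T-≡ b<ᵇa)))

    unchanged : ∀ i j → ¬ (i ≡ a × j ≡ b) → upper B′ i j ≡ upper B i j
    unchanged i j ¬ab = begin
      mem B′ i j ∧ ord                          ≡⟨ cong (_∧ ord) (mem-add added i j) ⟩
      (mem B i j ∨ link a b i j) ∧ ord          ≡⟨ ∧-distribʳ-∨ ord (mem B i j) (link a b i j) ⟩
      (mem B i j ∧ ord) ∨ (link a b i j ∧ ord)  ≡⟨ cong ((mem B i j ∧ ord) ∨_) (oriented-link ¬ab) ⟩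
      (mem B i j ∧ ord) ∨ false                 ≡⟨ ∨-identityʳ _ ⟩
      mem B i j ∧ ord                           ∎
      where
      open ≡-Reasoning
      ord = toℕ i <ᵇ toℕ j

  edgeCount-withEdge : ∀ {B B′ : EdgeSubset G} {a b} → a ≢ b → WithEdge B a b B′ →
                       edgeCount B′ ≡ suc (edgeCount B)
  edgeCount-withEdge {a = a} {b} a≢b added with <-cmpᶠ a b
  ... | tri< a<b _ _ = edgeCount-withEdge< a<b added
  ... | tri≈ _ a≡b _ = contradiction a≡b a≢b
  ... | tri> _ _ b<a = edgeCount-withEdge< b<a (withEdge-swap added)

threeAt : ∀ {n} → Fin n → Fin n → ℕ
threeAt u v = if does (v ≟ᶠ u) then 3 else 0

threeAt-self : ∀ {n} (u : Fin n) → threeAt u u ≡ 3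
threeAt-self u = cong (if_then 3 else 0) (dec-true (u ≟ᶠ u) refl)

threeAt-other : ∀ {n} {u v : Fin n} → v ≢ u → threeAt u v ≡ 0
threeAt-other {u = u} {v} v≢u = cong (if_then 3 else 0) (dec-false (v ≟ᶠ u) v≢u)

weight-threeAt : ∀ {n} (u : Fin n) → weight (threeAt u) ≡ 3
weight-threeAt {suc n} u = trans (sumF-punchIn (threeAt u) u)
  (cong₂ _+_ (threeAt-self u) (sumF-zero (λ i → threeAt-other (punchInᵢ≢i u i))))

threeAt-isDRDF : ∀ {n} (H : Graph n) {u} → Universal H u → IsDRDF H (threeAt u)
threeAt-isDRDF {n} H {u} univ = bounded , zeroDominated , oneDominated
  where
  bounded : ∀ v → threeAt u v ≤ 3
  bounded v with v ≟ᶠ u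
  ... | yes _ = ≤-refl
  ... | no  _ = z≤n

  zeroDominated : ∀ v → threeAt u v ≡ 0 →
    (Σ (Fin n) λ x → Σ (Fin n) λ x′ →
       x ≢ x′ × Adj H v x × Adj H v x′ × threeAt u x ≡ 2 × threeAt u x′ ≡ 2)
    ⊎ (Σ (Fin n) λ w → Adj H v w × threeAt u w ≡ 3)
  zeroDominated v fv with v ≟ᶠ u
  ... | no v≢u = inj₂ (u , trans (Graph.sym H v u) (univ v (≢-sym v≢u)) , threeAt-self u)

  oneDominated : ∀ v → threeAt u v ≡ 1 → Σ (Fin n) λ w → Adj H v w × 2 ≤ threeAt u w
  oneDominated v fv with v ≟ᶠ u
  oneDominated v () | yes _
  oneDominated v () | no _

four≰three : ¬ (4 ≤ 3)
four≰three = 1+n≰n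

zeroFree⇒heavyVertex : ∀ {n} {H : Graph n} {f} → IsDRDF H f → (∀ v → f v ≢ 0) → Fin n →
                       ∃ λ w → 2 ≤ f w
zeroFree⇒heavyVertex {f = f} (_ , _ , oneDominated) zeroFree v with f v in fv
... | zero        = contradiction fv (zeroFree v)
... | suc zero    = Product.map₂ proj₂ (oneDominated v fv)
... | suc (suc _) = v , subst (2 ≤_) (sym fv) (s≤s (s≤s z≤n))

zeroFree⇒4≤weight : ∀ {n} {H : Graph (3 + n)} {f} → IsDRDF H f → (∀ v → f v ≢ 0) → 4 ≤ weight f
zeroFree⇒4≤weight {n} {H} {f} drdf zeroFree with zeroFree⇒heavyVertex {H = H} drdf zeroFree Fin.zero
... | w , 2≤fw = begin
  4                              ≤⟨ m≤m+n 4 n ⟩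
  2 + (2 + n)                    ≤⟨ +-mono-≤ 2≤fw (n≤sumF (λ i → n≢0⇒n>0 (zeroFree (punchIn w i)))) ⟩
  f w + sumF (f ∘ punchIn w)     ≡⟨ sym (sumF-punchIn f w) ⟩
  weight f                       ∎
  where open ≤-Reasoning

noHeavyPair : ∀ {n} (f : Fin n → ℕ) → weight f ≤ 3 → ∀ {i j} → i ≢ j → ¬ (4 ≤ f i + f j)
noHeavyPair f light i≢j heavy = four≰three (≤-trans heavy (≤-trans (pair≤sumF f i≢j) light))

heavy⇒othersZero : ∀ {n} (f : Fin n → ℕ) → weight f ≤ 3 →
                   ∀ {w x} → f w ≡ 3 → w ≢ x → f x ≡ 0
heavy⇒othersZero f light {w} {x} fw w≢x = n≤0⇒n≡0 (+-cancelˡ-≤ 3 (f x) 0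
  (≤-trans (subst (λ t → t + f x ≤ weight f) fw (pair≤sumF f w≢x)) light))

heavy⇒universal : ∀ {n} {H : Graph n} {f} → weight f ≤ 3 → IsDRDF H f →
                  ∀ {w} → f w ≡ 3 → Universal H w
heavy⇒universal {H = H} {f} light (_ , zeroDominated , _) {w} fw x w≢x
  with zeroDominated x (heavy⇒othersZero f light fw w≢x)
... | inj₁ (u , u′ , u≢u′ , _ , _ , fu , fu′) =
      ⊥-elim (noHeavyPair f light u≢u′ (≤-reflexive (cong₂ _+_ (sym fu) (sym fu′))))
... | inj₂ (w′ , xw′ , fw′) with w′ ≟ᶠ w
...   | yes refl = trans (Graph.sym H w x) xw′
...   | no w′≢w  = ⊥-elim (noHeavyPair f light w′≢w
        (subst (4 ≤_) (cong₂ _+_ (sym fw′) (sym fw)) (m≤m+n 4 2)))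

lightDRDF⇒universal : ∀ {n} {H : Graph (3 + n)} {f} → IsDRDF H f → weight f ≤ 3 →
                      ∃ λ w → f w ≡ 3 × Universal H w
lightDRDF⇒universal {H = H} {f} drdf light with any? (λ v → f v ≟ 0)
... | no noZero =
      ⊥-elim (four≰three (≤-trans (zeroFree⇒4≤weight {H = H} drdf (λ v fv → noZero (v , fv))) light))
... | yes (v , fv) with proj₁ (proj₂ drdf) v fv
...   | inj₁ (u , u′ , u≢u′ , _ , _ , fu , fu′) =
        ⊥-elim (noHeavyPair f light u≢u′ (≤-reflexive (cong₂ _+_ (sym fu) (sym fu′))))
...   | inj₂ (w , _ , fw) = w , fw , heavy⇒universal {H = H} light drdf fw

universal⇒γdR≡3 : ∀ {n} (H : Graph (3 + n)) {u} → Universal H u → IsGammaDR H 3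
universal⇒γdR≡3 H {u} univ = (threeAt u , threeAt-isDRDF H univ , weight-threeAt u) , minimal
  where
  minimal : ∀ f → IsDRDF H f → 3 ≤ weight f
  minimal f drdf with weight f ≤? 3
  ... | no  heavy = <⇒≤ (≰⇒> heavy)
  ... | yes light with lightDRDF⇒universal {H = H} drdf light
  ...   | w , fw , _ = subst (_≤ weight f) fw (point≤sumF f w)

numFullDegree-pos⇒γdR≡3 : ∀ {n} (H : Graph (3 + n)) → 1 ≤ numFullDegree H → IsGammaDR H 3
numFullDegree-pos⇒γdR≡3 H pos = universal⇒γdR≡3 H (proj₂ (numFullDegree-pos⇒universal H pos))

noUniversal⇒4≤weight : ∀ {n} {H : Graph (3 + n)} → (∀ w → ¬ Universal H w) →
                       ∀ f → IsDRDF H f → 4 ≤ weight f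
noUniversal⇒4≤weight {H = H} noUniv f drdf with weight f ≤? 3
... | no  heavy = ≰⇒> heavy
... | yes light = ⊥-elim (noUniv _ (proj₂ (proj₂ (lightDRDF⇒universal {H = H} drdf light))))

n≤m+m⇒⌈n/2⌉≤m : ∀ {k m} → k ≤ m + m → ⌈ k /2⌉ ≤ m
n≤m+m⇒⌈n/2⌉≤m {m = m} k≤m+m = subst (_ ≤_) (sym (n≡⌈n+n/2⌉ m)) (⌈n/2⌉-mono k≤m+m)

module _ {n} (G : Graph (3 + n)) where

  remainingFull : EdgeSubset G → ℕ
  remainingFull B = numFullDegree (deleteEdges G B)

  noEdges : EdgeSubset G
  noEdges = record { mem = λ _ _ → false ; memSym = λ _ _ → refl ; memSub = λ _ _ () }

  edgeCount-noEdges : edgeCount noEdges ≡ 0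
  edgeCount-noEdges = sumF-zero (λ i → count-false {p = upper noEdges i} (λ j → refl))

  remainingFull-edgeless : ∀ B → (∀ i j → mem B i j ≡ false) → remainingFull B ≡ numFullDegree G
  remainingFull-edgeless B edgeless = count-cong λ v → cong (_≡ᵇ (2 + n)) (count-cong λ j →
    trans (cong (λ m → adj G v j ∧ not m) (edgeless v j)) (∧-identityʳ (adj G v j)))

  addEdge : ∀ B {a b} → Adj (deleteEdges G B) a b → ∃ λ B′ → WithEdge B a b B′
  addEdge B {a} {b} ab = insertEdge B inG , withEdge-insert B inG (not-true (∧-conicalʳ _ _ ab))
    where
    inG : Adj G a b
    inG = ∧-conicalˡ _ _ ab
    not-true : ∀ {x} → not x ≡ true → x ≡ false
    not-true {false} _ = refl

  removeFullEdge : ∀ B {x y} → full (deleteEdges G B) x ≡ true → x ≢ y →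
                   ∃ λ B′ → edgeCount B′ ≡ suc (edgeCount B) ×
                     1 + ind (full (deleteEdges G B) y) + remainingFull B′ ≤ remainingFull B
  removeFullEdge B {x} {y} fx x≢y with addEdge B (full⇒universal (deleteEdges G B) fx y x≢y)
  ... | B′ , added = B′ , edgeCount-withEdge x≢y added ,
        subst (λ t → ind t + ind (full (deleteEdges G B) y) + remainingFull B′ ≤ remainingFull B) fx
          (numFullDegree-loses-endpoints x≢y (deleteEdges-withEdge added))

  clearFull : ∀ c B → remainingFull B ≤ c →
              ∃ λ B′ → remainingFull B′ ≡ 0 × edgeCount B′ ≤ edgeCount B + ⌈ c /2⌉
  clearFull c B bound with any? (λ x → full (deleteEdges G B) x ≟ᵇ true)
  ... | no noFull = B , count-false (λ x → ¬-not (noFull ∘ (x ,_))) , m≤m+n _ _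
  ... | yes (x , fx) with any? (λ y → full (deleteEdges G B) (punchIn x y) ≟ᵇ true)
  ...   | no noOther with removeFullEdge B fx (≢-sym (punchInᵢ≢i x Fin.zero))
  ...     | B′ , grown , drop = B′ , cleared , edges
    where
    partnerFull : ℕ
    partnerFull = ind (full (deleteEdges G B) (punchIn x Fin.zero))
    onlyX : remainingFull B ≡ 1
    onlyX = trans (count-punchIn (full (deleteEdges G B)) x)
      (cong₂ (λ t r → ind t + r) fx (count-false (λ y → ¬-not (noOther ∘ (y ,_)))))
    cleared : remainingFull B′ ≡ 0
    cleared = n≤0⇒n≡0 (m+n≤o⇒n≤o partnerFull
      (≤-pred (subst (1 + partnerFull + remainingFull B′ ≤_) onlyX drop)))
    edges : edgeCount B′ ≤ edgeCount B + ⌈ c /2⌉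
    edges = begin
      edgeCount B′        ≡⟨ trans grown (+-comm 1 (edgeCount B)) ⟩
      edgeCount B + 1     ≤⟨ +-monoʳ-≤ (edgeCount B) (⌈n/2⌉-mono (subst (_≤ c) onlyX bound)) ⟩
      edgeCount B + ⌈ c /2⌉ ∎
      where open ≤-Reasoning
  clearFull c B bound | yes (x , fx) | yes (y , fy)
    with removeFullEdge B fx (≢-sym (punchInᵢ≢i x y))
  ... | B′ , grown , drop
    with c | ≤-trans (subst (λ t → 1 + ind t + remainingFull B′ ≤ remainingFull B) fy drop) bound
  ... | .(suc (suc c′)) | s≤s (s≤s {n = c′} remaining≤c′) with clearFull c′ B′ remaining≤c′
  ... | B″ , cleared , edges = B″ , cleared ,
        ≤-trans edges (≤-reflexive (trans (cong (_+ ⌈ c′ /2⌉) grown)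
                                          (sym (+-suc (edgeCount B) ⌈ c′ /2⌉))))

  dropEdge : ∀ B {a b} → mem B a b ≡ true →
             ∃ λ B₀ → edgeCount B ≡ suc (edgeCount B₀) × remainingFull B₀ ≤ 2 + remainingFull B
  dropEdge B {a} {b} ab∈B = removeEdge B a b , edgeCount-withEdge a≢b added ,
    numFullDegree-loses-≤2 a≢b (deleteEdges-withEdge added)
    where
    a≢b : a ≢ b
    a≢b = adj⇒≢ G (memSub B a b ab∈B)
    added : WithEdge (removeEdge B a b) a b B
    added = withEdge-remove B ab∈B

  numFullDegree≤2|B|+remainingFull : ∀ m B → edgeCount B ≡ m →
                                     numFullDegree G ≤ (m + m) + remainingFull B
  numFullDegree≤2|B|+remainingFull m B |B|≡m with any? (λ a → any? (λ b → mem B a b ≟ᵇ true))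
  ... | no noEdge = begin
    numFullDegree G            ≡⟨ sym (remainingFull-edgeless B (λ i j → ¬-not (noEdge ∘ (i ,_) ∘ (j ,_)))) ⟩
    remainingFull B            ≤⟨ m≤n+m (remainingFull B) (m + m) ⟩
    (m + m) + remainingFull B  ∎
    where open ≤-Reasoning
  ... | yes (a , b , ab∈B) with dropEdge B ab∈B
  ...   | B₀ , shrunk , rise with m | trans (sym shrunk) |B|≡m
  ...     | suc m′ | |B₀|≡m′ = begin
    numFullDegree G                      ≤⟨ numFullDegree≤2|B|+remainingFull m′ B₀ (suc-injective |B₀|≡m′) ⟩
    (m′ + m′) + remainingFull B₀          ≤⟨ +-monoʳ-≤ (m′ + m′) rise ⟩
    (m′ + m′) + (2 + remainingFull B)     ≡⟨ regroup m′ (remainingFull B) ⟩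
    (suc m′ + suc m′) + remainingFull B   ∎
    where
    open ≤-Reasoning
    regroup : ∀ m r → (m + m) + (2 + r) ≡ (suc m + suc m) + r
    regroup = solve-∀

  clearing-increases : ∀ B {u} → Universal G u → remainingFull B ≡ 0 → IncreasesGammaDR G B
  clearing-increases B {u} univ cleared g g′ (_ , g-min) ((f′ , drdf′ , weight≡g′) , _) = begin-strict
    g                  ≤⟨ g-min (threeAt u) (threeAt-isDRDF G univ) ⟩
    weight (threeAt u) ≡⟨ weight-threeAt u ⟩
    3                  <⟨ ≤-refl ⟩
    4                  ≤⟨ noUniversal⇒4≤weight {H = deleteEdges G B} noUniversal f′ drdf′ ⟩
    weight f′          ≡⟨ weight≡g′ ⟩
    g′                 ∎
    where
    open ≤-Reasoning
    noUniversal : ∀ w → ¬ Universal (deleteEdges G B) w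
    noUniversal w univ′ =
      contradiction (subst (1 ≤_) cleared (universal⇒numFullDegree-pos (deleteEdges G B) univ′)) λ ()

  bondage-upper : 1 ≤ numFullDegree G →
                  ∃ λ B → IncreasesGammaDR G B × edgeCount B ≤ ⌈ numFullDegree G /2⌉
  bondage-upper someFull
    with numFullDegree-pos⇒universal G someFull
       | clearFull (numFullDegree G) noEdges (≤-reflexive (remainingFull-edgeless noEdges (λ _ _ → refl)))
  ... | u , univ | B , cleared , size = B , clearing-increases B univ cleared ,
        subst (λ e → edgeCount B ≤ e + ⌈ numFullDegree G /2⌉) edgeCount-noEdges size

  bondage-lower : 1 ≤ numFullDegree G → ∀ B → IncreasesGammaDR G B →
                  ⌈ numFullDegree G /2⌉ ≤ edgeCount B
  bondage-lower someFull B increases with ⌈ numFullDegree G /2⌉ ≤? edgeCount B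
  ... | yes enough = enough
  ... | no few = contradiction
    (increases 3 3 (numFullDegree-pos⇒γdR≡3 G someFull)
                   (numFullDegree-pos⇒γdR≡3 (deleteEdges G B) someLeft))
    (<-irrefl refl)
    where
    someLeft : 1 ≤ remainingFull B
    someLeft = n≢0⇒n>0 λ noneLeft → few (n≤m+m⇒⌈n/2⌉≤m (begin
      numFullDegree G
        ≤⟨ numFullDegree≤2|B|+remainingFull (edgeCount B) B refl ⟩
      (edgeCount B + edgeCount B) + remainingFull B
        ≡⟨ cong (edgeCount B + edgeCount B +_) noneLeft ⟩
      (edgeCount B + edgeCount B) + 0
        ≡⟨ +-identityʳ _ ⟩
      edgeCount B + edgeCount B
        ∎))
      where open ≤-Reasoning

corollary2p3 : (n : ℕ) → 3 ≤ n → (G : Graph n) → (k : ℕ) → 1 ≤ k →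
    numFullDegree G ≡ k → IsDRBondage G ⌈ k /2⌉
corollary2p3 (suc (suc (suc n))) (s≤s (s≤s (s≤s _))) G _ someFull refl with bondage-upper G someFull
... | B , increases , size =
  (B , increases , ≤-antisym size (bondage-lower G someFull B increases)) , bondage-lower G someFull
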